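{- Let $A(x),B(x)\in\mathbb{Z}[x]$ be coprime monic polynomials, let $\Delta$ be their resultant, and let $G(n)=\gcd(A(n),B(n))$ for $n\in\mathbb{Z}$. Let $\ell\le\deg(A)+\deg(B)$ and let $n_1,\dots,n_\ell\in\mathbb{Z}$ and integers $q_1,\dots,q_\ell$ be such that $q_i$ divides $G(n_i)$ for $i=1,\dots,\ell$. Then $q_1q_2\cdots q_\ell$ divides $\Delta\times\prod_{1\le i<j\le\ell}(n_j-n_i)$. In particular, if $p$ is a prime, $p^{\omega_1}$ divides $G(n_1)$ and $p^{\omega_2}$ divides $G(n_2)$, then $\nu_p(n_2-n_1)\ge\omega_1+\omega_2-\nu_p(\Delta)$.
   Context: For monic $A(x)=x^d+\cdots+a_0$ and $B(x)=x^e+\cdots+b_0$, the resultant $\Delta$ is the determinant of the $(d+e)\times(d+e)$ Sylvester matrix, whose first $e$ columns contain the coefficients of $A$ (from leading to constant) shifted down by one row in each successive column, and whose last $d$ columns contain the coefficients of $B$ shifted down by one row in each successive column. $\nu_p$ denotes the $p$-adic valuation, with $\nu_p(0)=+\infty$. -}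

module Defs where

open import Data.Nat as ℕ using (ℕ; zero; suc; _≤?_; _<?_)
open import Data.Integer as ℤ using (ℤ; +_; _+_; _*_; _-_; -_; _^_)
open import Data.Integer.Divisibility using (_∣_)
open import Data.Integer.GCD using (gcd)
open import Data.Fin as Fin using (Fin; toℕ; punchIn)
open import Data.List using (List; []; _∷_; map; upTo)
open import Data.Product using (Σ; ∃; _×_)
open import Relation.Binary.PropositionalEquality using (_≡_; _≢_)
open import Relation.Nullary using (¬_; does)
open import Data.Bool using (if_then_else_)

sumTo : ℕ → (ℕ → ℤ) → ℤ
sumTo zero    f = + 0
sumTo (suc n) f = sumTo n f + f n

sumFin : (m : ℕ) → (Fin m → ℤ) → ℤ
sumFin zero    f = + 0
sumFin (suc m) f = f Fin.zero + sumFin m (λ i → f (Fin.suc i))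

prodFin : (m : ℕ) → (Fin m → ℤ) → ℤ
prodFin zero    f = + 1
prodFin (suc m) f = f Fin.zero * prodFin m (λ i → f (Fin.suc i))

-- Polynomials in ℤ[x]: coefficient lists, constant term first.

Poly : Set
Poly = List ℤ

coeff : Poly → ℕ → ℤ
coeff []       _       = + 0
coeff (c ∷ cs) zero    = c
coeff (c ∷ cs) (suc i) = coeff cs i

mulCoeff : Poly → Poly → ℕ → ℤ
mulCoeff P Q k = sumTo (suc k) (λ i → coeff P i * coeff Q (k ℕ.∸ i))

_∣ₚ_ : Poly → Poly → Set
C ∣ₚ P = ∃ λ (Q : Poly) → ∀ k → mulCoeff C Q k ≡ coeff P k

Nonconstant : Poly → Set
Nonconstant C = ∃ λ i → coeff C (suc i) ≢ + 0

Coprime : Poly → Poly → Set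
Coprime A B = ∀ (C : Poly) → C ∣ₚ A → C ∣ₚ B → ¬ Nonconstant C

-- Monic polynomials x^d + a_{d-1} x^{d-1} + ... + a_0

record Monic : Set where
  constructor monic
  field
    deg   : ℕ
    lower : Fin deg → ℤ
open Monic public

mcoeff : Monic → ℕ → ℤ
mcoeff (monic d a) i with i <? d
... | Relation.Nullary.yes i<d = a (Fin.fromℕ< i<d)
... | Relation.Nullary.no _ with i ℕ.≟ d
...   | Relation.Nullary.yes _ = + 1
...   | Relation.Nullary.no _  = + 0

toPoly : Monic → Poly
toPoly A = map (mcoeff A) (upTo (suc (deg A)))

eval : Monic → ℤ → ℤ
eval A n = sumTo (suc (deg A)) (λ i → mcoeff A i * (n ^ i))

sgn : ℕ → ℤ
sgn zero          = + 1
sgn (suc zero)    = - (+ 1)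
sgn (suc (suc i)) = sgn i

det : (m : ℕ) → (Fin m → Fin m → ℤ) → ℤ
det zero    M = + 1
det (suc m) M =
  sumFin (suc m) (λ i → sgn (toℕ i) * M i Fin.zero
                          * det m (λ r c → M (punchIn i r) (Fin.suc c)))

-- Sylvester matrix: entry of a column holding the coefficients of a monic
-- polynomial of degree d (from leading to constant), shifted down by s rows.
sylEntry : Monic → (s r : ℕ) → ℤ
sylEntry A s r with s ≤? r
... | Relation.Nullary.no _ = + 0
... | Relation.Nullary.yes _ with (r ℕ.∸ s) ≤? deg A
...   | Relation.Nullary.yes _ = mcoeff A (deg A ℕ.∸ (r ℕ.∸ s))
...   | Relation.Nullary.no _  = + 0

-- (d+e)×(d+e) Sylvester matrix, entries indexed (row, column):
-- first e columns: A shifted; last d columns: B shifted.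
sylvester : (A B : Monic) → Fin (deg A ℕ.+ deg B) → Fin (deg A ℕ.+ deg B) → ℤ
sylvester A B r c with toℕ c <? deg B
... | Relation.Nullary.yes _ = sylEntry A (toℕ c) (toℕ r)
... | Relation.Nullary.no _  = sylEntry B (toℕ c ℕ.∸ deg B) (toℕ r)

resultant : Monic → Monic → ℤ
resultant A B = det (deg A ℕ.+ deg B) (sylvester A B)

G : Monic → Monic → ℤ → ℤ
G A B n = gcd (eval A n) (eval B n)

vandermonde : (ℓ : ℕ) → (Fin ℓ → ℤ) → ℤ
vandermonde ℓ n =
  prodFin ℓ (λ j → prodFin ℓ (λ i →
    if does (toℕ i <? toℕ j) then n j - n i else + 1))

HasValuation : ℕ → ℤ → ℕ → Set
HasValuation p x v = ((+ p) ^ v ∣ x) × ¬ ((+ p) ^ suc v ∣ x)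

module Submission where

-- Read the Sylvester matrix S row by row, the row of x^m (m < N = deg A + deg B) holding the
-- coefficients of x^m in the polynomials x^s A(x), x^s B(x) of its columns. Replacing the row of x^i
-- (i < ℓ) by the evaluation Σ_m n_i^m (row of x^m) gives a matrix whose i-th new row consists of values
-- n_i^s A(n_i), n_i^s B(n_i), all divisible by G(n_i) and hence by q_i, so q_1⋯q_ℓ divides its
-- determinant. In the Newton basis of the nodes n_i these evaluation rows are triangular combinations
-- of Newton rows, which are themselves unitriangular combinations of the rows of S; hence the
-- determinant is Δ ∏_{i<j}(n_j - n_i). The valuation bound is the case ℓ = 2.

open import Defs
open import Data.Nat as ℕ using (ℕ; zero; suc; _∸_; z≤n; s≤s; _≤_; _<_)
import Data.Nat.Properties as ℕP
open import Data.Nat.Primality using (Prime; euclidsLemma; prime⇒nonZero; prime⇒nonTrivial)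
import Data.Nat.Divisibility as ℕ∣
open ℕ∣ using () renaming (_∣_ to _∣ℕ_)
open import Data.Integer as ℤ using (ℤ; +_; _+_; _*_; -_; _-_; _^_)
import Data.Integer.Properties as ℤP
open import Data.Integer.Tactic.RingSolver using (solve-∀)
import Data.Nat.Tactic.RingSolver as ℕSolver
open import Data.Integer.Divisibility using (_∣_)
import Data.Integer.Divisibility.Signed as ∣′
open ∣′ using () renaming (_∣_ to _∣′_)
open import Data.Integer.GCD using (gcd; gcd[i,j]∣i; gcd[i,j]∣j; gcd-zeroˡ; gcd-zeroʳ)
open import Data.Fin as Fin using (Fin; toℕ; punchIn; punchOut)
import Data.Fin.Properties as FinP
open import Data.Product using (_×_; _,_; proj₁; proj₂; Σ-syntax)
open import Data.Sum using (_⊎_; inj₁; inj₂)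
open import Data.Empty using (⊥-elim)
open import Function using (_∘_)
open import Data.Vec.Functional using (updateAt)
open import Data.Vec.Functional.Properties using (updateAt-updates; updateAt-minimal)
open import Algebra.Properties.AbelianGroup ℤP.+-0-abelianGroup using (inverseʳ-unique)
open import Relation.Nullary using (¬_; yes; no; does)
open import Relation.Nullary.Decidable using (dec-true; dec-false)
open import Data.Bool using (if_then_else_)
open import Relation.Binary.PropositionalEquality
open import Relation.Binary.Definitions using (tri<; tri≈; tri>)

m<n∸o⇒o+m<n : ∀ {m} n o → m < n ∸ o → o ℕ.+ m < n
m<n∸o⇒o+m<n (suc n) zero    m<n   = m<n
m<n∸o⇒o+m<n (suc n) (suc o) m<n∸o = s≤s (m<n∸o⇒o+m<n n o m<n∸o)

o+m<n⇒m<n∸o : ∀ {m} n o → o ℕ.+ m < n → m < n ∸ o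
o+m<n⇒m<n∸o n       zero    m<n         = m<n
o+m<n⇒m<n∸o (suc n) (suc o) (s≤s o+m<n) = o+m<n⇒m<n∸o n o o+m<n

m≡n+1+o⇒m∸[1+n]≡o : ∀ {m} n o → m ≡ n ℕ.+ suc o → m ∸ suc n ≡ o
m≡n+1+o⇒m∸[1+n]≡o n o refl = trans (cong (_∸ suc n) (ℕP.+-suc n o)) (ℕP.m+n∸m≡n n o)

sumTo-cong : ∀ n {f g : ℕ → ℤ} → (∀ i → i < n → f i ≡ g i) → sumTo n f ≡ sumTo n g
sumTo-cong zero    f≗g = refl
sumTo-cong (suc n) f≗g =
  cong₂ _+_ (sumTo-cong n (λ i i<n → f≗g i (ℕP.m<n⇒m<1+n i<n))) (f≗g n (ℕP.n<1+n n))

sumTo-zero : ∀ n {f : ℕ → ℤ} → (∀ i → i < n → f i ≡ + 0) → sumTo n f ≡ + 0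
sumTo-zero zero    f≗0 = refl
sumTo-zero (suc n) f≗0 =
  cong₂ _+_ (sumTo-zero n (λ i i<n → f≗0 i (ℕP.m<n⇒m<1+n i<n))) (f≗0 n (ℕP.n<1+n n))

sumTo-+ : ∀ a b (f : ℕ → ℤ) → sumTo (a ℕ.+ b) f ≡ sumTo a f + sumTo b (λ i → f (a ℕ.+ i))
sumTo-+ a zero    f = trans (cong (λ k → sumTo k f) (ℕP.+-identityʳ a)) (sym (ℤP.+-identityʳ _))
sumTo-+ a (suc b) f = begin
  sumTo (a ℕ.+ suc b) f                                 ≡⟨ cong (λ k → sumTo k f) (ℕP.+-suc a b) ⟩
  sumTo (a ℕ.+ b) f + f (a ℕ.+ b)                       ≡⟨ cong (_+ f (a ℕ.+ b)) (sumTo-+ a b f) ⟩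
  sumTo a f + sumTo b (λ i → f (a ℕ.+ i)) + f (a ℕ.+ b) ≡⟨ ℤP.+-assoc (sumTo a f) _ _ ⟩
  sumTo a f + sumTo (suc b) (λ i → f (a ℕ.+ i))         ∎
  where open ≡-Reasoning

sumTo-*ˡ : ∀ n (a : ℤ) (f : ℕ → ℤ) → sumTo n (λ i → a * f i) ≡ a * sumTo n f
sumTo-*ˡ zero    a f = sym (ℤP.*-zeroʳ a)
sumTo-*ˡ (suc n) a f = trans (cong (_+ a * f n) (sumTo-*ˡ n a f)) (sym (ℤP.*-distribˡ-+ a _ _))

sumTo-sucˡ : ∀ n (f : ℕ → ℤ) → sumTo (suc n) f ≡ f 0 + sumTo n (f ∘ suc)
sumTo-sucˡ zero    f = ℤP.+-comm (+ 0) (f 0)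
sumTo-sucˡ (suc n) f = trans (cong (_+ f (suc n)) (sumTo-sucˡ n f)) (ℤP.+-assoc (f 0) _ _)

sumTo-window : ∀ s d k (f g : ℕ → ℤ) →
  (∀ i → i < s → f i ≡ + 0) → (∀ i → i < d → f (s ℕ.+ i) ≡ g i) →
  (∀ j → j < k → f (s ℕ.+ d ℕ.+ j) ≡ + 0) →
  sumTo (s ℕ.+ d ℕ.+ k) f ≡ sumTo d g
sumTo-window s d k f g before inside after = begin
  sumTo (s ℕ.+ d ℕ.+ k) f                                     ≡⟨ sumTo-+ (s ℕ.+ d) k f ⟩
  sumTo (s ℕ.+ d) f + sumTo k (λ j → f (s ℕ.+ d ℕ.+ j))       ≡⟨ cong₂ _+_ (sumTo-+ s d f) (sumTo-zero k after) ⟩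
  sumTo s f + sumTo d (λ i → f (s ℕ.+ i)) + + 0               ≡⟨ ℤP.+-identityʳ _ ⟩
  sumTo s f + sumTo d (λ i → f (s ℕ.+ i))                     ≡⟨ cong₂ _+_ (sumTo-zero s before) (sumTo-cong d inside) ⟩
  + 0 + sumTo d g                                             ≡⟨ ℤP.+-identityˡ _ ⟩
  sumTo d g                                                   ∎
  where open ≡-Reasoning

sumFin-cong : ∀ n {f g : Fin n → ℤ} → (∀ i → f i ≡ g i) → sumFin n f ≡ sumFin n g
sumFin-cong zero    f≗g = refl
sumFin-cong (suc n) f≗g = cong₂ _+_ (f≗g Fin.zero) (sumFin-cong n (f≗g ∘ Fin.suc))

sumFin-linear : ∀ n (a : ℤ) (f g : Fin n → ℤ) →
  sumFin n (λ i → a * f i + g i) ≡ a * sumFin n f + sumFin n g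
sumFin-linear zero    a f g = zero≡a*0+0 a
  where
  zero≡a*0+0 : ∀ a → + 0 ≡ a * + 0 + + 0
  zero≡a*0+0 = solve-∀
sumFin-linear (suc n) a f g =
  trans (cong (_+_ (a * f Fin.zero + g Fin.zero)) (sumFin-linear n a (f ∘ Fin.suc) (g ∘ Fin.suc)))
        (interchange a _ _ _ _)
  where
  interchange : ∀ a x y u v → (a * x + y) + (a * u + v) ≡ a * (x + u) + (y + v)
  interchange = solve-∀

sumFin-zero : ∀ n {f : Fin n → ℤ} → (∀ i → f i ≡ + 0) → sumFin n f ≡ + 0
sumFin-zero zero    f≗0 = refl
sumFin-zero (suc n) f≗0 = cong₂ _+_ (f≗0 Fin.zero) (sumFin-zero n (f≗0 ∘ Fin.suc))

sumFin-single : ∀ n {f : Fin n → ℤ} a → (∀ i → i ≢ a → f i ≡ + 0) → sumFin n f ≡ f a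
sumFin-single (suc n) {f} Fin.zero    f≗0 =
  trans (cong (_+_ (f Fin.zero)) (sumFin-zero n (λ i → f≗0 (Fin.suc i) (λ ())))) (ℤP.+-identityʳ _)
sumFin-single (suc n) {f} (Fin.suc a) f≗0 =
  trans (cong₂ _+_ (f≗0 Fin.zero (λ ()))
                   (sumFin-single n a (λ i i≢a → f≗0 (Fin.suc i) (i≢a ∘ FinP.suc-injective))))
        (ℤP.+-identityˡ _)

sumFin-pair : ∀ n {f : Fin n → ℤ} a b → a ≢ b →
  (∀ i → i ≢ a → i ≢ b → f i ≡ + 0) → sumFin n f ≡ f a + f b
sumFin-pair (suc n)     Fin.zero    Fin.zero    a≢b f≗0 = ⊥-elim (a≢b refl)
sumFin-pair (suc n) {f} Fin.zero    (Fin.suc b) a≢b f≗0 =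
  cong (_+_ (f Fin.zero)) (sumFin-single n b (λ i i≢b → f≗0 (Fin.suc i) (λ ()) (i≢b ∘ FinP.suc-injective)))
sumFin-pair (suc n) {f} (Fin.suc a) Fin.zero    a≢b f≗0 =
  trans (cong (_+_ (f Fin.zero)) (sumFin-single n a (λ i i≢a → f≗0 (Fin.suc i) (i≢a ∘ FinP.suc-injective) (λ ()))))
        (ℤP.+-comm (f Fin.zero) (f (Fin.suc a)))
sumFin-pair (suc n) {f} (Fin.suc a) (Fin.suc b) a≢b f≗0 =
  trans (cong₂ _+_ (f≗0 Fin.zero (λ ()) (λ ()))
          (sumFin-pair n a b (a≢b ∘ cong Fin.suc)
            (λ i i≢a i≢b → f≗0 (Fin.suc i) (i≢a ∘ FinP.suc-injective) (i≢b ∘ FinP.suc-injective))))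
        (ℤP.+-identityˡ _)

prodTo : ℕ → (ℕ → ℤ) → ℤ
prodTo zero    f = + 1
prodTo (suc n) f = prodTo n f * f n

prodTo-cong : ∀ n {f g : ℕ → ℤ} → (∀ i → i < n → f i ≡ g i) → prodTo n f ≡ prodTo n g
prodTo-cong zero    f≗g = refl
prodTo-cong (suc n) f≗g =
  cong₂ _*_ (prodTo-cong n (λ i i<n → f≗g i (ℕP.m<n⇒m<1+n i<n))) (f≗g n (ℕP.n<1+n n))

prodTo-sucˡ : ∀ n (f : ℕ → ℤ) → prodTo (suc n) f ≡ f 0 * prodTo n (f ∘ suc)
prodTo-sucˡ zero    f = ℤP.*-comm (+ 1) (f 0)
prodTo-sucˡ (suc n) f = trans (cong (_* f (suc n)) (prodTo-sucˡ n f)) (ℤP.*-assoc (f 0) _ _)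

prodTo-truncate : ∀ k j (g : ℕ → ℤ) → k ≤ j →
  prodTo j (λ i → if does (i ℕ.<? k) then g i else + 1) ≡ prodTo k g
prodTo-truncate k zero    g z≤n   = refl
prodTo-truncate k (suc j) g k≤1+j with k ℕ.≟ suc j
... | yes refl   = prodTo-cong (suc j) (λ i i<k → cong (if_then g i else + 1) (dec-true (i ℕ.<? k) i<k))
... | no  k≢1+j  =
  trans (cong₂ _*_ (prodTo-truncate k j g k≤j) (cong (if_then g j else + 1) (dec-false (j ℕ.<? k) (ℕP.≤⇒≯ k≤j))))
        (ℤP.*-identityʳ _)
  where k≤j = ℕP.≤-pred (ℕP.≤∧≢⇒< k≤1+j k≢1+j)

-- Determinants

Row : ℕ → Set
Row n = Fin n → ℤ

Matrix : ℕ → Set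
Matrix n = Fin n → Row n

minor : ∀ {m} → Matrix (suc m) → Fin (suc m) → Matrix m
minor M i r c = M (punchIn i r) (Fin.suc c)

cofactorTerm : ∀ {m} → Matrix (suc m) → Fin (suc m) → ℤ
cofactorTerm {m} M i = sgn (toℕ i) * M i Fin.zero * det m (minor M i)

sgn-suc : ∀ k → sgn (suc k) ≡ - sgn k
sgn-suc zero          = refl
sgn-suc (suc zero)    = refl
sgn-suc (suc (suc k)) = sgn-suc k

det-cong : ∀ m {M N : Matrix m} → (∀ r c → M r c ≡ N r c) → det m M ≡ det m N
det-cong zero    M≗N = refl
det-cong (suc m) M≗N = sumFin-cong (suc m) λ i →
  cong₂ (λ x y → sgn (toℕ i) * x * y) (M≗N i Fin.zero)
        (det-cong m (λ r c → M≗N (punchIn i r) (Fin.suc c)))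

punchIn≢ : ∀ {n} (i : Fin (suc n)) {k} (i≢k : i ≢ k) (r : Fin n) →
  r ≢ punchOut i≢k → punchIn i r ≢ k
punchIn≢ i i≢k r r≢k' eq =
  r≢k' (FinP.punchIn-injective i r _ (trans eq (sym (FinP.punchIn-punchOut i≢k))))

det-linear : ∀ m (M X Y : Matrix m) k (a : ℤ) →
  (∀ r → r ≢ k → ∀ c → M r c ≡ X r c) →
  (∀ r → r ≢ k → ∀ c → M r c ≡ Y r c) →
  (∀ c → M k c ≡ a * X k c + Y k c) →
  det m M ≡ a * det m X + det m Y
det-linear (suc m) M X Y k a M≗X M≗Y Mk =
  trans (sumFin-cong (suc m) term-linear) (sumFin-linear (suc m) a (cofactorTerm X) (cofactorTerm Y))
  where
  term-linear : ∀ i → cofactorTerm M i ≡ a * cofactorTerm X i + cofactorTerm Y i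
  term-linear i with i Fin.≟ k
  ... | yes refl =
    trans (cong₂ (λ x d → sgn (toℕ i) * x * d) (Mk Fin.zero) minorX)
      (trans (distrib (sgn (toℕ i)) a (X i Fin.zero) (Y i Fin.zero) (det m (minor X i)))
        (cong (λ d → a * cofactorTerm X i + sgn (toℕ i) * Y i Fin.zero * d) (trans (sym minorX) minorY)))
    where
    distrib : ∀ s a x y d → s * (a * x + y) * d ≡ a * (s * x * d) + s * y * d
    distrib = solve-∀
    minorX = det-cong m (λ r c → M≗X (punchIn i r) (FinP.punchInᵢ≢i i r) (Fin.suc c))
    minorY = det-cong m (λ r c → M≗Y (punchIn i r) (FinP.punchInᵢ≢i i r) (Fin.suc c))
  ... | no i≢k =
    trans (cong₂ (λ v d → sgn (toℕ i) * v * d) (M≗X i i≢k Fin.zero) minor-linear)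
      (trans (distrib (sgn (toℕ i)) (X i Fin.zero) a (det m (minor X i)) (det m (minor Y i)))
        (cong (λ v → a * cofactorTerm X i + sgn (toℕ i) * v * det m (minor Y i))
              (trans (sym (M≗X i i≢k Fin.zero)) (M≗Y i i≢k Fin.zero))))
    where
    distrib : ∀ s v a x y → s * v * (a * x + y) ≡ a * (s * v * x) + s * v * y
    distrib = solve-∀
    minor-linear : det m (minor M i) ≡ a * det m (minor X i) + det m (minor Y i)
    minor-linear = det-linear m (minor M i) (minor X i) (minor Y i) (punchOut i≢k) a
      (λ r r≢ c → M≗X (punchIn i r) (punchIn≢ i i≢k r r≢) (Fin.suc c))
      (λ r r≢ c → M≗Y (punchIn i r) (punchIn≢ i i≢k r r≢) (Fin.suc c))
      (λ c → subst (λ z → M z (Fin.suc c) ≡ a * X z (Fin.suc c) + Y z (Fin.suc c))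
                   (sym (FinP.punchIn-punchOut i≢k)) (Mk (Fin.suc c)))

det-additive : ∀ m (M X Y : Matrix m) k →
  (∀ r → r ≢ k → ∀ c → M r c ≡ X r c) →
  (∀ r → r ≢ k → ∀ c → M r c ≡ Y r c) →
  (∀ c → M k c ≡ X k c + Y k c) →
  det m M ≡ det m X + det m Y
det-additive m M X Y k M≗X M≗Y Mk =
  trans (det-linear m M X Y k (+ 1) M≗X M≗Y (λ c → trans (Mk c) (cong (_+ Y k c) (sym (ℤP.*-identityˡ (X k c))))))
        (cong (_+ det m Y) (ℤP.*-identityˡ (det m X)))

det-zero-row : ∀ m (M : Matrix m) k → (∀ c → M k c ≡ + 0) → det m M ≡ + 0
det-zero-row m M k Mk≗0 =
  x≡x+x⇒x≡0 (det m M) (det-additive m M M M k (λ _ _ _ → refl) (λ _ _ _ → refl)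
    (λ c → trans (Mk≗0 c) (sym (cong₂ _+_ (Mk≗0 c) (Mk≗0 c)))))
  where
  x≡x+x-x : ∀ x → x ≡ x + x - x
  x≡x+x-x = solve-∀
  x≡x+x⇒x≡0 : ∀ x → x ≡ x + x → x ≡ + 0
  x≡x+x⇒x≡0 x eq = trans (x≡x+x-x x) (trans (cong (_- x) (sym eq)) (ℤP.+-inverseʳ x))

toℕ≤toℕ-punchIn : ∀ {n} (i : Fin (suc n)) j → toℕ j ≤ toℕ (punchIn i j)
toℕ≤toℕ-punchIn Fin.zero    j           = ℕP.n≤1+n _
toℕ≤toℕ-punchIn (Fin.suc i) Fin.zero    = z≤n
toℕ≤toℕ-punchIn (Fin.suc i) (Fin.suc j) = s≤s (toℕ≤toℕ-punchIn i j)

punchIn-reflects-adjacent : ∀ {n} (i : Fin (suc n)) (a b : Fin n) →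
  toℕ (punchIn i b) ≡ suc (toℕ (punchIn i a)) → toℕ b ≡ suc (toℕ a)
punchIn-reflects-adjacent Fin.zero    a           b           eq = ℕP.suc-injective eq
punchIn-reflects-adjacent (Fin.suc i) Fin.zero    Fin.zero    ()
punchIn-reflects-adjacent (Fin.suc i) Fin.zero    (Fin.suc b) eq =
  cong suc (ℕP.n≤0⇒n≡0 (subst (toℕ b ≤_) (ℕP.suc-injective eq) (toℕ≤toℕ-punchIn i b)))
punchIn-reflects-adjacent (Fin.suc i) (Fin.suc a) Fin.zero    ()
punchIn-reflects-adjacent (Fin.suc i) (Fin.suc a) (Fin.suc b) eq =
  cong suc (punchIn-reflects-adjacent i a b (ℕP.suc-injective eq))

punchIn-adjacent : ∀ {n} (a b : Fin (suc n)) (x : Fin n) → toℕ b ≡ suc (toℕ a) →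
  punchIn a x ≡ punchIn b x ⊎ (punchIn a x ≡ b × punchIn b x ≡ a)
punchIn-adjacent Fin.zero    Fin.zero                x           ()
punchIn-adjacent Fin.zero    (Fin.suc Fin.zero)      Fin.zero    eq = inj₂ (refl , refl)
punchIn-adjacent Fin.zero    (Fin.suc Fin.zero)      (Fin.suc x) eq = inj₁ refl
punchIn-adjacent Fin.zero    (Fin.suc (Fin.suc b))   x           ()
punchIn-adjacent (Fin.suc a) Fin.zero                x           ()
punchIn-adjacent (Fin.suc a) (Fin.suc b)             Fin.zero    eq = inj₁ refl
punchIn-adjacent (Fin.suc a) (Fin.suc b)             (Fin.suc x) eq
  with punchIn-adjacent a b x (ℕP.suc-injective eq)
... | inj₁ e         = inj₁ (cong Fin.suc e)
... | inj₂ (e₁ , e₂) = inj₂ (cong Fin.suc e₁ , cong Fin.suc e₂)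

adjacent⇒≢ : ∀ {m} {a b : Fin m} → toℕ b ≡ suc (toℕ a) → a ≢ b
adjacent⇒≢ {a = a} adj a≡b = ℕP.<⇒≢ (ℕP.n<1+n (toℕ a)) (trans (cong toℕ a≡b) adj)

-- The cofactor terms of rows a and b cancel: their minors coincide and their signs differ.
det-equal-adjacent-rows : ∀ m (M : Matrix m) a b → toℕ b ≡ suc (toℕ a) →
  (∀ c → M a c ≡ M b c) → det m M ≡ + 0
det-equal-adjacent-rows (suc m) M a b adj Ma≗Mb =
  trans (sumFin-pair (suc m) a b (adjacent⇒≢ adj) other-terms) paired-terms
  where
  other-terms : ∀ i → i ≢ a → i ≢ b → cofactorTerm M i ≡ + 0
  other-terms i i≢a i≢b =
    trans (cong (sgn (toℕ i) * M i Fin.zero *_) minor≡0) (ℤP.*-zeroʳ (sgn (toℕ i) * M i Fin.zero))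
    where
    pa = FinP.punchIn-punchOut i≢a
    pb = FinP.punchIn-punchOut i≢b
    minor≡0 : det m (minor M i) ≡ + 0
    minor≡0 = det-equal-adjacent-rows m (minor M i) (punchOut i≢a) (punchOut i≢b)
      (punchIn-reflects-adjacent i _ _ (subst₂ (λ u v → toℕ v ≡ suc (toℕ u)) (sym pa) (sym pb) adj))
      (λ c → subst₂ (λ u v → M u (Fin.suc c) ≡ M v (Fin.suc c)) (sym pa) (sym pb) (Ma≗Mb (Fin.suc c)))
  minors-equal : ∀ r c → minor M a r c ≡ minor M b r c
  minors-equal r c with punchIn-adjacent a b r adj
  ... | inj₁ e         = cong (λ z → M z (Fin.suc c)) e
  ... | inj₂ (e₁ , e₂) = trans (cong (λ z → M z (Fin.suc c)) e₁)
                           (trans (sym (Ma≗Mb (Fin.suc c))) (cong (λ z → M z (Fin.suc c)) (sym e₂)))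
  cancel : ∀ s v d → s * v * d + (- s) * v * d ≡ + 0
  cancel = solve-∀
  paired-terms : cofactorTerm M a + cofactorTerm M b ≡ + 0
  paired-terms =
    trans (cong₂ (λ s (p : ℤ × ℤ) → cofactorTerm M a + s * proj₁ p * proj₂ p)
                 (trans (cong sgn adj) (sgn-suc (toℕ a)))
                 (cong₂ _,_ (sym (Ma≗Mb Fin.zero)) (sym (det-cong m minors-equal))))
          (cancel (sgn (toℕ a)) (M a Fin.zero) (det m (minor M a)))

setRow : ∀ {m} → Matrix m → Fin m → Row m → Matrix m
setRow M k v = updateAt M k (λ _ → v)

setRow-updates : ∀ {m} (M : Matrix m) k v c → setRow M k v k c ≡ v c
setRow-updates M k v = cong-app (updateAt-updates k M)

setRow-minimal : ∀ {m} (M : Matrix m) k v r → r ≢ k → ∀ c → setRow M k v r c ≡ M r c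
setRow-minimal M k v r r≢k = cong-app (updateAt-minimal r k M r≢k)

det-setRow-additive : ∀ m (M : Matrix m) k (x y : Row m) →
  det m (setRow M k (λ c → x c + y c)) ≡ det m (setRow M k x) + det m (setRow M k y)
det-setRow-additive m M k x y = det-additive m _ _ _ k
  (λ r r≢k c → trans (setRow-minimal M k _ r r≢k c) (sym (setRow-minimal M k x r r≢k c)))
  (λ r r≢k c → trans (setRow-minimal M k _ r r≢k c) (sym (setRow-minimal M k y r r≢k c)))
  (λ c → trans (setRow-updates M k _ c) (sym (cong₂ _+_ (setRow-updates M k x c) (setRow-updates M k y c))))

setRow-comm : ∀ {m} (M : Matrix m) {j j'} → j ≢ j' → ∀ x y r c →
  setRow (setRow M j' y) j x r c ≡ setRow (setRow M j x) j' y r c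
setRow-comm M {j} {j'} j≢j' x y r c with r Fin.≟ j | r Fin.≟ j'
... | yes refl | _        = trans (setRow-updates _ j x c)
                              (sym (trans (setRow-minimal _ j' y j j≢j' c) (setRow-updates M j x c)))
... | no r≢j   | yes refl = trans (setRow-minimal _ j x j' r≢j c)
                              (trans (setRow-updates M j' y c) (sym (setRow-updates _ j' y c)))
... | no r≢j   | no r≢j'  = trans (setRow-minimal _ j x r r≢j c)
                              (trans (setRow-minimal M j' y r r≢j' c)
                                (sym (trans (setRow-minimal _ j' y r r≢j' c) (setRow-minimal M j x r r≢j c))))

-- Expand the determinant with rows j, j' both equal to (row j + row j') by additivity in each.
det-swap-adjacent : ∀ m (M : Matrix m) j j' → toℕ j' ≡ suc (toℕ j) →
  det m (setRow (setRow M j' (M j)) j (M j')) ≡ - det m M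
det-swap-adjacent m M j j' adj = inverseʳ-unique (det m M) (E v u) (begin
  det m M + E v u                                ≡⟨ cong₂ _+_ (ℤP.+-identityˡ (det m M)) (ℤP.+-identityʳ (E v u)) ⟨
  (+ 0 + det m M) + (E v u + + 0)                ≡⟨ cong₂ _+_ (cong₂ _+_ (E-diagonal u) E-original)
                                                              (cong (_+_ (E v u)) (E-diagonal v)) ⟨
  (E u u + E u v) + (E v u + E v v)              ≡⟨ cong₂ _+_ (E-additiveʳ u u v) (E-additiveʳ v u v) ⟨
  E u (λ c → u c + v c) + E v (λ c → u c + v c)  ≡⟨ det-setRow-additive m _ j u v ⟨
  E (λ c → u c + v c) (λ c → u c + v c)          ≡⟨ E-diagonal (λ c → u c + v c) ⟩
  + 0                                            ∎)
  where
  open ≡-Reasoning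
  u = M j
  v = M j'
  j≢j' = adjacent⇒≢ adj

  E : Row m → Row m → ℤ
  E x y = det m (setRow (setRow M j' y) j x)

  E-additiveʳ : ∀ x y y' → E x (λ c → y c + y' c) ≡ E x y + E x y'
  E-additiveʳ x y y' = begin
    E x (λ c → y c + y' c)                         ≡⟨ det-cong m (setRow-comm M j≢j' x _) ⟩
    det m (setRow (setRow M j x) j' (λ c → y c + y' c)) ≡⟨ det-setRow-additive m _ j' y y' ⟩
    det m (setRow (setRow M j x) j' y) + det m (setRow (setRow M j x) j' y')
      ≡⟨ cong₂ _+_ (det-cong m (setRow-comm M j≢j' x y)) (det-cong m (setRow-comm M j≢j' x y')) ⟨
    E x y + E x y'                                 ∎

  E-diagonal : ∀ x → E x x ≡ + 0
  E-diagonal x = det-equal-adjacent-rows m _ j j' adj λ c →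
    trans (setRow-updates _ j x c) (sym (trans (setRow-comm M j≢j' x x j' c) (setRow-updates _ j' x c)))

  E-original : E u v ≡ det m M
  E-original = det-cong m unchanged
    where
    unchanged : ∀ r c → setRow (setRow M j' v) j u r c ≡ M r c
    unchanged r c with r Fin.≟ j | r Fin.≟ j'
    ... | yes refl | _        = setRow-updates _ j u c
    ... | no r≢j   | yes refl = trans (setRow-minimal _ j u j' r≢j c) (setRow-updates M j' v c)
    ... | no r≢j   | no r≢j'  = trans (setRow-minimal _ j u r r≢j c) (setRow-minimal M j' v r r≢j' c)

det-equal-rows-at-distance : ∀ g m (M : Matrix m) i j → suc (toℕ i) ℕ.+ g ≡ toℕ j →
  (∀ c → M i c ≡ M j c) → det m M ≡ + 0
det-equal-rows-at-distance zero    m M i j dist Mi≗Mj =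
  det-equal-adjacent-rows m M i j (trans (sym dist) (ℕP.+-identityʳ _)) Mi≗Mj
det-equal-rows-at-distance (suc g) m M i j dist Mi≗Mj =
  trans (sym (ℤP.neg-involutive (det m M)))
    (trans (cong -_ (sym (det-swap-adjacent m M j' j adj))) (cong -_ swapped≡0))
  where
  j'<m : suc (toℕ i) ℕ.+ g < m
  j'<m = ℕP.<-trans (subst (suc (toℕ i) ℕ.+ g <_) dist (ℕP.+-monoʳ-< (suc (toℕ i)) (ℕP.n<1+n g)))
                    (FinP.toℕ<n j)
  j' : Fin m
  j' = Fin.fromℕ< j'<m
  toℕj' : toℕ j' ≡ suc (toℕ i) ℕ.+ g
  toℕj' = FinP.toℕ-fromℕ< j'<m
  adj : toℕ j ≡ suc (toℕ j')
  adj = trans (sym dist) (trans (ℕP.+-suc (suc (toℕ i)) g) (cong suc (sym toℕj')))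
  i≢j' : i ≢ j'
  i≢j' = ℕP.<⇒≢ (subst (toℕ i <_) (sym toℕj') (ℕP.m≤m+n (suc (toℕ i)) g)) ∘ cong toℕ
  i≢j : i ≢ j
  i≢j = ℕP.<⇒≢ (subst (toℕ i <_) dist (ℕP.m≤m+n (suc (toℕ i)) (suc g))) ∘ cong toℕ
  swapped = setRow (setRow M j (M j')) j' (M j)
  swapped≡0 : det m swapped ≡ + 0
  swapped≡0 = det-equal-rows-at-distance g m swapped i j' (sym toℕj')
    (λ c → trans (setRow-minimal _ j' _ i i≢j' c)
             (trans (setRow-minimal M j _ i i≢j c) (trans (Mi≗Mj c) (sym (setRow-updates _ j' (M j) c)))))

det-equal-rows : ∀ m (M : Matrix m) i j → i ≢ j → (∀ c → M i c ≡ M j c) → det m M ≡ + 0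
det-equal-rows m M i j i≢j Mi≗Mj with ℕP.<-cmp (toℕ i) (toℕ j)
... | tri< i<j _ _ = let g , dist = ℕP.m≤n⇒∃[o]m+o≡n i<j in
  det-equal-rows-at-distance g m M i j dist Mi≗Mj
... | tri≈ _ i≡j _ = ⊥-elim (i≢j (FinP.toℕ-injective i≡j))
... | tri> _ _ j<i = let g , dist = ℕP.m≤n⇒∃[o]m+o≡n j<i in
  det-equal-rows-at-distance g m M j i dist (sym ∘ Mi≗Mj)

data Span {I : Set} {n} (F : I → Row n) (P : I → Set) : Row n → Set where
  nil  : ∀ {w} → (∀ c → w c ≡ + 0) → Span F P w
  cons : ∀ {w w'} i → P i → (a : ℤ) → (∀ c → w c ≡ a * F i c + w' c) →
         Span F P w' → Span F P w

module _ {I : Set} {n} {F : I → Row n} where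

  span-cong : ∀ {P w w'} → (∀ c → w c ≡ w' c) → Span F P w → Span F P w'
  span-cong w≗w' (nil w≗0)           = nil (λ c → trans (sym (w≗w' c)) (w≗0 c))
  span-cong w≗w' (cons i p a w≡ sp) = cons i p a (λ c → trans (sym (w≗w' c)) (w≡ c)) sp

  span-mono : ∀ {P Q : I → Set} {w} → (∀ i → P i → Q i) → Span F P w → Span F Q w
  span-mono P⇒Q (nil w≗0)           = nil w≗0
  span-mono P⇒Q (cons i p a w≡ sp) = cons i (P⇒Q i p) a w≡ (span-mono P⇒Q sp)

  span-generator : ∀ {P : I → Set} i → P i → Span F P (F i)
  span-generator i p =
    cons i p (+ 1) (λ c → trans (sym (ℤP.*-identityˡ _)) (sym (ℤP.+-identityʳ _))) (nil (λ _ → refl))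

  span-+ : ∀ {P w v} → Span F P w → Span F P v → Span F P (λ c → w c + v c)
  span-+ (nil w≗0) sv =
    span-cong (λ c → trans (sym (ℤP.+-identityˡ _)) (cong (_+ _) (sym (w≗0 c)))) sv
  span-+ {v = v} (cons i p a w≡ sw) sv =
    cons i p a (λ c → trans (cong (_+ v c) (w≡ c)) (ℤP.+-assoc (a * F i c) _ (v c))) (span-+ sw sv)

  span-* : ∀ {P w} (s : ℤ) → Span F P w → Span F P (λ c → s * w c)
  span-* s (nil w≗0) = nil (λ c → trans (cong (s *_) (w≗0 c)) (ℤP.*-zeroʳ s))
  span-* s (cons i p a w≡ sw) =
    cons i p (s * a) (λ c → trans (cong (s *_) (w≡ c)) (distrib s a (F i c) _)) (span-* s sw)
    where
    distrib : ∀ s a x w → s * (a * x + w) ≡ (s * a) * x + s * w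
    distrib = solve-∀

span-trans : ∀ {I J : Set} {n} {F : I → Row n} {G : J → Row n} {P : I → Set} {Q : J → Set} {w} →
  (∀ i → P i → Span G Q (F i)) → Span F P w → Span G Q w
span-trans F⊆G (nil w≗0) = nil w≗0
span-trans F⊆G (cons i p a w≡ sw) =
  span-cong (λ c → sym (w≡ c)) (span-+ (span-* a (F⊆G i p)) (span-trans F⊆G sw))

det-replaceRow : ∀ m (M M' : Matrix m) k (a : ℤ) (w : Row m) →
  (∀ r → r ≢ k → ∀ c → M' r c ≡ M r c) →
  (∀ c → M' k c ≡ a * M k c + w c) →
  Span M (_≢ k) w → det m M' ≡ a * det m M
det-replaceRow m M M' k a w M'≗M M'k (nil w≗0) =
  trans (det-linear m M' M zeroRow k a M'≗M
          (λ r r≢k c → trans (M'≗M r r≢k c) (sym (setRow-minimal M k _ r r≢k c)))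
          (λ c → trans (M'k c) (cong (_+_ (a * M k c)) (trans (w≗0 c) (sym (setRow-updates M k _ c))))))
        (trans (cong (_+_ (a * det m M)) (det-zero-row m zeroRow k (setRow-updates M k _)))
               (ℤP.+-identityʳ _))
  where zeroRow = setRow M k (λ _ → + 0)
det-replaceRow m M M' k a w M'≗M M'k (cons {w' = w'} i i≢k b w≡ sw) =
  trans (det-linear m M' withMi withRest k b
          (λ r r≢k c → sym (setRow-minimal M' k _ r r≢k c))
          (λ r r≢k c → sym (setRow-minimal M' k _ r r≢k c))
          (λ c → trans (M'k c) (trans (cong (_+_ (a * M k c)) (w≡ c))
                   (trans (reorder a (M k c) b (M i c) (w' c))
                     (cong₂ (λ u v → b * u + v) (sym (setRow-updates M' k _ c)) (sym (setRow-updates M' k _ c)))))))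
        (trans (cong₂ (λ u v → b * u + v) withMi≡0 withRest≡) (b*0+x≡x b _))
  where
  reorder : ∀ a x b y w → a * x + (b * y + w) ≡ b * y + (a * x + w)
  reorder = solve-∀
  b*0+x≡x : ∀ b x → b * + 0 + x ≡ x
  b*0+x≡x = solve-∀
  withMi   = setRow M' k (M i)
  withRest = setRow M' k (λ c → a * M k c + w' c)
  withMi≡0 : det m withMi ≡ + 0
  withMi≡0 = det-equal-rows m withMi k i (i≢k ∘ sym)
    (λ c → trans (setRow-updates M' k _ c) (sym (trans (setRow-minimal M' k _ i i≢k c) (M'≗M i i≢k c))))
  withRest≡ : det m withRest ≡ a * det m M
  withRest≡ = det-replaceRow m M withRest k a w'
    (λ r r≢k c → trans (setRow-minimal M' k _ r r≢k c) (M'≗M r r≢k c)) (setRow-updates M' k _) sw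

-- Row families are indexed by the power of x they multiply; the Sylvester matrix puts the row of
-- x^m at position N-1-m.
bottomUp : ∀ {N} → (ℕ → Row N) → Matrix N
bottomUp W r = W (toℕ (Fin.opposite r))

det-bottomUp-cong : ∀ N {W W' : ℕ → Row N} → (∀ m → m < N → ∀ c → W m c ≡ W' m c) →
  det N (bottomUp W) ≡ det N (bottomUp W')
det-bottomUp-cong N W≗W' = det-cong N (λ r → W≗W' _ (FinP.toℕ<n (Fin.opposite r)))

det-bottomUp-replaceRow : ∀ N (W W' : ℕ → Row N) k → k < N → (a : ℤ) (w : Row N) →
  (∀ m → m < N → m ≢ k → ∀ c → W' m c ≡ W m c) →
  (∀ c → W' k c ≡ a * W k c + w c) →
  Span W (λ m → m < N × m ≢ k) w → det N (bottomUp W') ≡ a * det N (bottomUp W)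
det-bottomUp-replaceRow N W W' k k<N a w W'≗W W'k sw =
  det-replaceRow N (bottomUp W) (bottomUp W') (row k<N) a w
    (λ r r≢rowₖ → W'≗W _ (FinP.toℕ<n _) (r≢rowₖ ∘ row-unique k<N r))
    (λ c → subst (λ z → W' z c ≡ a * W z c + w c) (sym (position k<N)) (W'k c))
    (span-trans (λ m (m<N , m≢k) → span-cong (λ c → cong (λ z → W z c) (position m<N))
                   (span-generator (row m<N) (m≢k ∘ row-injective m<N k<N)))
                sw)
  where
  row : ∀ {m} → m < N → Fin N
  row m<N = Fin.opposite (Fin.fromℕ< m<N)
  position : ∀ {m} (m<N : m < N) → toℕ (Fin.opposite (row m<N)) ≡ m
  position m<N = trans (cong toℕ (FinP.opposite-involutive _)) (FinP.toℕ-fromℕ< m<N)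
  row-unique : ∀ {m} (m<N : m < N) r → toℕ (Fin.opposite r) ≡ m → r ≡ row m<N
  row-unique m<N r eq = trans (sym (FinP.opposite-involutive r))
    (cong Fin.opposite (FinP.toℕ-injective (trans eq (sym (FinP.toℕ-fromℕ< m<N)))))
  row-injective : ∀ {m k} (m<N : m < N) (k<N : k < N) → row m<N ≡ row k<N → m ≡ k
  row-injective m<N k<N eq = trans (sym (position m<N)) (trans (cong (toℕ ∘ Fin.opposite) eq) (position k<N))

det-divisible-rows : ∀ N ℓ (W : ℕ → Row N) (q : ℕ → ℤ) → ℓ ≤ N →
  (∀ m → m < ℓ → ∀ c → q m ∣′ W m c) → prodTo ℓ q ∣′ det N (bottomUp W)
det-divisible-rows N zero    W q _   _   = ∣′.divides (det N (bottomUp W)) (sym (ℤP.*-identityʳ _))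
det-divisible-rows N (suc ℓ) W q ℓ<N q∣W =
  subst (prodTo (suc ℓ) q ∣′_) (sym det≡)
    (∣′.*-monoˡ-∣ (q ℓ) (det-divisible-rows N ℓ divided q (ℕP.<⇒≤ ℓ<N) q∣divided))
  where
  divided : ℕ → Row N
  divided m c with m ℕ.≟ ℓ
  ... | yes _ = ∣′.quotient (q∣W ℓ (ℕP.n<1+n ℓ) c)
  ... | no  _ = W m c
  divided-≢ : ∀ m → m ≢ ℓ → ∀ c → divided m c ≡ W m c
  divided-≢ m m≢ℓ c with m ℕ.≟ ℓ
  ... | yes m≡ℓ = ⊥-elim (m≢ℓ m≡ℓ)
  ... | no  _   = refl
  divided-ℓ : ∀ c → W ℓ c ≡ q ℓ * divided ℓ c + + 0
  divided-ℓ c with ℓ ℕ.≟ ℓ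
  ... | yes _   = trans (∣′._∣_.equality (q∣W ℓ (ℕP.n<1+n ℓ) c))
                    (trans (ℤP.*-comm _ (q ℓ)) (sym (ℤP.+-identityʳ _)))
  ... | no  ℓ≢ℓ = ⊥-elim (ℓ≢ℓ refl)
  q∣divided : ∀ m → m < ℓ → ∀ c → q m ∣′ divided m c
  q∣divided m m<ℓ c = subst (q m ∣′_) (sym (divided-≢ m (ℕP.<⇒≢ m<ℓ) c)) (q∣W m (ℕP.m<n⇒m<1+n m<ℓ) c)
  det≡ : det N (bottomUp W) ≡ det N (bottomUp divided) * q ℓ
  det≡ = trans (det-bottomUp-replaceRow N divided W ℓ ℓ<N (q ℓ) (λ _ → + 0)
                 (λ m _ m≢ℓ c → sym (divided-≢ m m≢ℓ c)) divided-ℓ (nil (λ _ → refl)))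
               (ℤP.*-comm (q ℓ) _)

-- Polynomials with row coefficients and Newton interpolation

prefix : ∀ {A : Set} → ℕ → (ℕ → A) → (ℕ → A) → ℕ → A
prefix i F G m with m ℕ.<? i
... | yes _ = F m
... | no  _ = G m

module _ {A : Set} {F G : ℕ → A} where

  prefix-< : ∀ {i m} → m < i → prefix i F G m ≡ F m
  prefix-< {i} {m} m<i with m ℕ.<? i
  ... | yes _   = refl
  ... | no  m≮i = ⊥-elim (m≮i m<i)

  prefix-≮ : ∀ {i m} → ¬ m < i → prefix i F G m ≡ G m
  prefix-≮ {i} {m} m≮i with m ℕ.<? i
  ... | yes m<i = ⊥-elim (m≮i m<i)
  ... | no  _   = refl

  prefix-suc : ∀ {i m} → m ≢ i → prefix (suc i) F G m ≡ prefix i F G m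
  prefix-suc {i} {m} m≢i with m ℕ.<? i
  ... | yes m<i = prefix-< (ℕP.m<n⇒m<1+n m<i)
  ... | no  m≮i = prefix-≮ (λ m<1+i → m≮i (ℕP.≤∧≢⇒< (ℕP.≤-pred m<1+i) m≢i))

prefix-absorb : ∀ {A : Set} {F G H : ℕ → A} i m → prefix i F (prefix i H G) m ≡ prefix i F G m
prefix-absorb i m with m ℕ.<? i
... | yes m<i = refl
... | no  m≮i = prefix-≮ m≮i

horner : ∀ {N} → ℕ → (ℕ → Row N) → ℤ → Row N
horner zero    C t c = + 0
horner (suc n) C t c = C 0 c + t * horner n (C ∘ suc) t c

horner-unfold : ∀ {N} {n n′} (C : ℕ → Row N) t → n ≡ suc n′ → ∀ c →
  horner n C t c ≡ C 0 c + t * horner n′ (C ∘ suc) t c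
horner-unfold C t refl c = refl

horner≡sumTo : ∀ {N} n (C : ℕ → Row N) x c → horner n C x c ≡ sumTo n (λ m → x ^ m * C m c)
horner≡sumTo zero    C x c = refl
horner≡sumTo (suc n) C x c = begin
  C 0 c + x * horner n (C ∘ suc) x c                      ≡⟨ cong (λ z → C 0 c + x * z) (horner≡sumTo n (C ∘ suc) x c) ⟩
  C 0 c + x * sumTo n (λ m → x ^ m * C (suc m) c)         ≡⟨ cong (_+_ (C 0 c)) (sumTo-*ˡ n x _) ⟨
  C 0 c + sumTo n (λ m → x * (x ^ m * C (suc m) c))       ≡⟨ cong₂ _+_ (ℤP.*-identityˡ (C 0 c))
                                                                       (sumTo-cong n (λ m _ → ℤP.*-assoc x (x ^ m) _)) ⟨
  + 1 * C 0 c + sumTo n (λ m → x ^ suc m * C (suc m) c)   ≡⟨ sumTo-sucˡ n (λ m → x ^ m * C m c) ⟨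
  sumTo (suc n) (λ m → x ^ m * C m c)                     ∎
  where open ≡-Reasoning

-- The quotient of horner n C by (x - s): syntheticDiv n C s m = Σ_{m<k<n} s^(k-m-1) C k.
syntheticDiv : ∀ {N} → ℕ → (ℕ → Row N) → ℤ → ℕ → Row N
syntheticDiv zero    C s m       c = + 0
syntheticDiv (suc n) C s zero    c = horner n (C ∘ suc) s c
syntheticDiv (suc n) C s (suc m) c = syntheticDiv n (C ∘ suc) s m c

horner-syntheticDiv : ∀ {N} n (C : ℕ → Row N) s t c →
  horner n C t c ≡ horner n C s c + (t - s) * horner (ℕ.pred n) (syntheticDiv n C s) t c
horner-syntheticDiv zero          C s t c = x≡x+d*0 (+ 0) (t - s)
  where
  x≡x+d*0 : ∀ x d → x ≡ x + d * + 0
  x≡x+d*0 = solve-∀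
horner-syntheticDiv (suc zero)    C s t c = identity (C 0 c) t s
  where
  identity : ∀ c₀ t s → c₀ + t * + 0 ≡ (c₀ + s * + 0) + (t - s) * + 0
  identity = solve-∀
horner-syntheticDiv (suc (suc n)) C s t c =
  trans (cong (λ z → C 0 c + t * z) (horner-syntheticDiv (suc n) (C ∘ suc) s t c))
        (identity (C 0 c) t s (horner (suc n) (C ∘ suc) s c) (horner n (syntheticDiv (suc n) (C ∘ suc) s) t c))
  where
  identity : ∀ c₀ t s x y → c₀ + t * (x + (t - s) * y) ≡ (c₀ + s * x) + (t - s) * (x + t * y)
  identity = solve-∀

syntheticDiv-unfold : ∀ {N} n (C : ℕ → Row N) s m → suc m < n → ∀ c →
  syntheticDiv n C s m c ≡ C (suc m) c + s * syntheticDiv n C s (suc m) c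
syntheticDiv-unfold (suc (suc n)) C s zero    _             c = refl
syntheticDiv-unfold (suc n)       C s (suc m) (s≤s 2+m<1+n) c = syntheticDiv-unfold n (C ∘ suc) s m 2+m<1+n c

module _ {N} {I : Set} {F : I → Row N} {P : I → Set} where

  horner-span : ∀ n (C : ℕ → Row N) t → (∀ m → m < n → Span F P (C m)) → Span F P (horner n C t)
  horner-span zero    C t C∈ = nil (λ _ → refl)
  horner-span (suc n) C t C∈ =
    span-+ (C∈ 0 (s≤s z≤n)) (span-* t (horner-span n (C ∘ suc) t (λ m m<n → C∈ (suc m) (s≤s m<n))))

  syntheticDiv-span : ∀ n (C : ℕ → Row N) s m → (∀ k → k < n → m < k → Span F P (C k)) →
    Span F P (syntheticDiv n C s m)
  syntheticDiv-span zero    C s m       C∈ = nil (λ _ → refl)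
  syntheticDiv-span (suc n) C s zero    C∈ =
    horner-span n (C ∘ suc) s (λ k k<n → C∈ (suc k) (s≤s k<n) (s≤s z≤n))
  syntheticDiv-span (suc n) C s (suc m) C∈ =
    syntheticDiv-span n (C ∘ suc) s m (λ k k<n m<k → C∈ (suc k) (s≤s k<n) (s≤s m<k))

newton : (ℕ → ℤ) → ℕ → ℤ → ℤ
newton t k x = prodTo k (λ i → x - t i)

newtonProduct : (ℕ → ℤ) → ℕ → ℤ
newtonProduct t ℓ = prodTo ℓ (λ k → newton t k (t k))

-- Newton interpolation at the nodes t 0, t 1, …: for P x = horner N B x, quotients k is the quotient
-- of P by (x - t 0)⋯(x - t (k-1)) and P x = Σ_{j<N} newton t j x * newtonRow j. So P (t i) is
-- newton t i (t i) * newtonRow i plus earlier Newton rows, while newtonRow j is B j plus later rows of B.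
module NewtonBasis {N} (B : ℕ → Row N) (t : ℕ → ℤ) where

  quotients : ℕ → ℕ → Row N
  quotients zero    = B
  quotients (suc k) = syntheticDiv (N ∸ k) (quotients k) (t k)

  newtonRow : ℕ → Row N
  newtonRow j = horner (N ∸ j) (quotients j) (t j)

  newton-expansion : ∀ k x →
    Span newtonRow (_< k) (λ c → horner N B x c - newton t k x * horner (N ∸ k) (quotients k) x c)
  newton-expansion zero    x = nil (λ c → x-1*x≡0 (horner N B x c))
    where
    x-1*x≡0 : ∀ x → x - + 1 * x ≡ + 0
    x-1*x≡0 = solve-∀
  newton-expansion (suc k) x =
    span-cong next (span-+ (span-mono (λ _ → ℕP.m<n⇒m<1+n) (newton-expansion k x))
                           (span-* (newton t k x) (span-generator k (ℕP.n<1+n k))))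
    where
    cancel : ∀ p n b d h → (p - n * (b + d * h)) + n * b ≡ p - n * d * h
    cancel = solve-∀
    next : ∀ c → (horner N B x c - newton t k x * horner (N ∸ k) (quotients k) x c) + newton t k x * newtonRow k c
               ≡ horner N B x c - newton t (suc k) x * horner (N ∸ suc k) (quotients (suc k)) x c
    next c = begin
      (horner N B x c - newton t k x * horner (N ∸ k) (quotients k) x c) + newton t k x * newtonRow k c
        ≡⟨ cong (λ z → horner N B x c - newton t k x * z + newton t k x * newtonRow k c)
                (horner-syntheticDiv (N ∸ k) (quotients k) (t k) x c) ⟩
      (horner N B x c - newton t k x * (newtonRow k c + (x - t k) * horner (ℕ.pred (N ∸ k)) (quotients (suc k)) x c))
        + newton t k x * newtonRow k c
        ≡⟨ cancel (horner N B x c) (newton t k x) (newtonRow k c) (x - t k) (horner (ℕ.pred (N ∸ k)) (quotients (suc k)) x c) ⟩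
      horner N B x c - newton t (suc k) x * horner (ℕ.pred (N ∸ k)) (quotients (suc k)) x c
        ≡⟨ cong (λ n → horner N B x c - newton t (suc k) x * horner n (quotients (suc k)) x c)
                (ℕP.pred[m∸n]≡m∸[1+n] N k) ⟩
      horner N B x c - newton t (suc k) x * horner (N ∸ suc k) (quotients (suc k)) x c ∎
      where open ≡-Reasoning

  evalRows : ℕ → ℕ → Row N
  evalRows ℓ = prefix ℓ (λ m → horner N B (t m)) B

  partlyNewton : ℕ → ℕ → ℕ → Row N
  partlyNewton ℓ i = prefix i newtonRow (evalRows ℓ)

  det-partlyNewton-suc : ∀ ℓ i → i < ℓ → ℓ ≤ N →
    det N (bottomUp (partlyNewton ℓ i)) ≡ newton t i (t i) * det N (bottomUp (partlyNewton ℓ (suc i)))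
  det-partlyNewton-suc ℓ i i<ℓ ℓ≤N =
    det-bottomUp-replaceRow N (partlyNewton ℓ (suc i)) (partlyNewton ℓ i) i i<N (newton t i (t i)) rest
      (λ m _ m≢i c → cong-app (sym (prefix-suc m≢i)) c)
      (λ c → begin
        partlyNewton ℓ i i c
          ≡⟨ cong-app (prefix-≮ {F = newtonRow} {G = evalRows ℓ} (ℕP.<-irrefl refl)) c ⟩
        evalRows ℓ i c
          ≡⟨ cong-app (prefix-< i<ℓ) c ⟩
        horner N B (t i) c
          ≡⟨ split (horner N B (t i) c) (newton t i (t i)) (newtonRow i c) ⟩
        newton t i (t i) * newtonRow i c + rest c
          ≡⟨ cong (λ v → newton t i (t i) * v c + rest c) (prefix-< {F = newtonRow} {G = evalRows ℓ} (ℕP.n<1+n i)) ⟨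
        newton t i (t i) * partlyNewton ℓ (suc i) i c + rest c ∎)
      (span-trans (λ j j<i → span-cong (cong-app (prefix-< {F = newtonRow} {G = evalRows ℓ} (ℕP.m<n⇒m<1+n j<i)))
                                       (span-generator j (ℕP.<-trans j<i i<N , ℕP.<⇒≢ j<i)))
                  (newton-expansion i (t i)))
    where
    open ≡-Reasoning
    i<N = ℕP.<-≤-trans i<ℓ ℓ≤N
    rest : Row N
    rest c = horner N B (t i) c - newton t i (t i) * newtonRow i c
    split : ∀ x a b → x ≡ a * b + (x - a * b)
    split = solve-∀

  det-partlyNewton : ∀ ℓ j → j ≤ ℓ → ℓ ≤ N →
    det N (bottomUp (partlyNewton ℓ 0)) ≡ newtonProduct t j * det N (bottomUp (partlyNewton ℓ j))
  det-partlyNewton ℓ zero    _   _   = sym (ℤP.*-identityˡ _)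
  det-partlyNewton ℓ (suc j) j<ℓ ℓ≤N =
    trans (det-partlyNewton ℓ j (ℕP.<⇒≤ j<ℓ) ℓ≤N)
      (trans (cong (newtonProduct t j *_) (det-partlyNewton-suc ℓ j j<ℓ ℓ≤N))
             (sym (ℤP.*-assoc (newtonProduct t j) (newton t j (t j)) _)))

  Above : ℕ → ℕ → Set
  Above i m = i < m × m < N

  Leading : ℕ → Row N → Set
  Leading i v = Σ[ w ∈ Row N ] (∀ c → v c ≡ B i c + w c) × Span B (Above i) w

  leading⇒span : ∀ {i j v} → j < i → i < N → Leading i v → Span B (Above j) v
  leading⇒span j<i i<N (w , v≗ , sw) =
    span-cong (λ c → sym (v≗ c))
      (span-+ (span-generator _ (j<i , i<N))
              (span-mono (λ m (i<m , m<N) → ℕP.<-trans j<i i<m , m<N) sw))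

  quotients-leading : ∀ k m → k ℕ.+ m < N → Leading (k ℕ.+ m) (quotients k m)
  quotients-leading zero    m _ = (λ _ → + 0) , (λ c → sym (ℤP.+-identityʳ _)) , nil (λ _ → refl)
  quotients-leading (suc k) m 1+k+m<N =
    subst (λ i → Leading i (quotients (suc k) m)) (ℕP.+-suc k m)
      ((λ c → w₁ c + t k * tail c) , split , span-+ w₁∈ (span-* (t k) tail∈))
    where
    Q = quotients k
    k+1+m<N : k ℕ.+ suc m < N
    k+1+m<N = subst (_< N) (sym (ℕP.+-suc k m)) 1+k+m<N
    tail = syntheticDiv (N ∸ k) Q (t k) (suc m)
    head = quotients-leading k (suc m) k+1+m<N
    w₁ = proj₁ head
    w₁∈ = proj₂ (proj₂ head)
    split : ∀ c → quotients (suc k) m c ≡ B (k ℕ.+ suc m) c + (w₁ c + t k * tail c)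
    split c = trans (syntheticDiv-unfold (N ∸ k) Q (t k) m (o+m<n⇒m<n∸o N k k+1+m<N) c)
                (trans (cong (_+ t k * tail c) (proj₁ (proj₂ head) c)) (ℤP.+-assoc (B (k ℕ.+ suc m) c) (w₁ c) (t k * tail c)))
    tail∈ : Span B (Above (k ℕ.+ suc m)) tail
    tail∈ = syntheticDiv-span (N ∸ k) Q (t k) (suc m) λ m′ m′<N∸k 1+m<m′ →
      leading⇒span (ℕP.+-monoʳ-< k 1+m<m′) (m<n∸o⇒o+m<n N k m′<N∸k)
                   (quotients-leading k m′ (m<n∸o⇒o+m<n N k m′<N∸k))

  newtonRow-leading : ∀ j → j < N → Leading j (newtonRow j)
  newtonRow-leading j j<N = (λ c → w₀ c + t j * tail c) , split , span-+ w₀∈ (span-* (t j) tail∈)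
    where
    head = subst (λ i → Leading i (quotients j 0)) (ℕP.+-identityʳ j)
                 (quotients-leading j 0 (subst (_< N) (sym (ℕP.+-identityʳ j)) j<N))
    w₀ = proj₁ head
    w₀∈ = proj₂ (proj₂ head)
    tail = horner (N ∸ suc j) (quotients j ∘ suc) (t j)
    split : ∀ c → newtonRow j c ≡ B j c + (w₀ c + t j * tail c)
    split c = trans (horner-unfold (quotients j) (t j) (ℕP.+-∸-assoc 1 j<N) c)
                (trans (cong (_+ t j * tail c) (proj₁ (proj₂ head) c)) (ℤP.+-assoc (B j c) (w₀ c) (t j * tail c)))
    tail∈ : Span B (Above j) tail
    tail∈ = horner-span (N ∸ suc j) (quotients j ∘ suc) (t j) λ m m<N∸1+j →
      let j+1+m<N = subst (_< N) (sym (ℕP.+-suc j m)) (m<n∸o⇒o+m<n N (suc j) m<N∸1+j) in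
      leading⇒span (ℕP.m<m+n j (s≤s z≤n)) j+1+m<N (quotients-leading j (suc m) j+1+m<N)

  det-prefixNewton : ∀ j → j ≤ N → det N (bottomUp (prefix j newtonRow B)) ≡ det N (bottomUp B)
  det-prefixNewton zero    _   = det-bottomUp-cong N (λ m _ → cong-app (prefix-≮ {F = newtonRow} {G = B} {i = 0} {m = m} (λ ())))
  det-prefixNewton (suc j) j<N =
    trans (det-bottomUp-replaceRow N (prefix j newtonRow B) (prefix (suc j) newtonRow B) j j<N (+ 1) w
            (λ m _ m≢j → cong-app (prefix-suc {F = newtonRow} m≢j)) row-j w∈rows)
          (trans (ℤP.*-identityˡ _) (det-prefixNewton j (ℕP.<⇒≤ j<N)))
    where
    open ≡-Reasoning
    w = proj₁ (newtonRow-leading j j<N)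
    row-j : ∀ c → prefix (suc j) newtonRow B j c ≡ + 1 * prefix j newtonRow B j c + w c
    row-j c = begin
      prefix (suc j) newtonRow B j c        ≡⟨ cong-app (prefix-< {G = B} (ℕP.n<1+n j)) c ⟩
      newtonRow j c                         ≡⟨ proj₁ (proj₂ (newtonRow-leading j j<N)) c ⟩
      B j c + w c                           ≡⟨ cong (_+ w c) (ℤP.*-identityˡ (B j c)) ⟨
      + 1 * B j c + w c                     ≡⟨ cong (λ v → + 1 * v c + w c) (prefix-≮ {F = newtonRow} {i = j} (ℕP.<-irrefl refl)) ⟨
      + 1 * prefix j newtonRow B j c + w c  ∎
    w∈rows : Span (prefix j newtonRow B) (λ m → m < N × m ≢ j) w
    w∈rows = span-trans (λ m (j<m , m<N) → span-cong (cong-app (prefix-≮ {F = newtonRow} {G = B} (ℕP.<-asym j<m)))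
                                             (span-generator m (m<N , ℕP.>⇒≢ j<m)))
                        (proj₂ (proj₂ (newtonRow-leading j j<N)))

  det-evalRows : ∀ ℓ → ℓ ≤ N → det N (bottomUp (evalRows ℓ)) ≡ newtonProduct t ℓ * det N (bottomUp B)
  det-evalRows ℓ ℓ≤N = begin
    det N (bottomUp (evalRows ℓ))
      ≡⟨ det-bottomUp-cong N (λ m _ → cong-app (prefix-≮ {F = newtonRow} {G = evalRows ℓ} {i = 0} {m = m} (λ ()))) ⟨
    det N (bottomUp (partlyNewton ℓ 0))
      ≡⟨ det-partlyNewton ℓ ℓ ℕP.≤-refl ℓ≤N ⟩
    newtonProduct t ℓ * det N (bottomUp (partlyNewton ℓ ℓ))
      ≡⟨ cong (newtonProduct t ℓ *_) (det-bottomUp-cong N (λ m _ → cong-app (prefix-absorb ℓ m))) ⟩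
    newtonProduct t ℓ * det N (bottomUp (prefix ℓ newtonRow B))
      ≡⟨ cong (newtonProduct t ℓ *_) (det-prefixNewton ℓ ℓ≤N) ⟩
    newtonProduct t ℓ * det N (bottomUp B) ∎
    where open ≡-Reasoning

-- The Sylvester matrix

sylEntry-before : ∀ P s r → r < s → sylEntry P s r ≡ + 0
sylEntry-before P s r r<s with s ℕ.≤? r
... | no  _   = refl
... | yes s≤r = ⊥-elim (ℕP.<-irrefl refl (ℕP.<-≤-trans r<s s≤r))

sylEntry-band : ∀ P s k → k ≤ deg P → sylEntry P s (k ℕ.+ s) ≡ mcoeff P (deg P ∸ k)
sylEntry-band P s k k≤d with s ℕ.≤? k ℕ.+ s
... | no  s≰k+s = ⊥-elim (s≰k+s (ℕP.m≤n+m s k))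
... | yes _ with (k ℕ.+ s ∸ s) ℕ.≤? deg P
...   | yes _ = cong (λ z → mcoeff P (deg P ∸ z)) (ℕP.m+n∸n≡m k s)
...   | no  ≰ = ⊥-elim (≰ (subst (_≤ deg P) (sym (ℕP.m+n∸n≡m k s)) k≤d))

sylEntry-beyond : ∀ P s k → deg P < k → sylEntry P s (k ℕ.+ s) ≡ + 0
sylEntry-beyond P s k d<k with s ℕ.≤? k ℕ.+ s
... | no  _ = refl
... | yes _ with (k ℕ.+ s ∸ s) ℕ.≤? deg P
...   | yes ≤ = ⊥-elim (ℕP.<⇒≱ d<k (subst (_≤ deg P) (ℕP.m+n∸n≡m k s) ≤))
...   | no  _ = refl


-- Read from the row of x^0 upward, a column holding the coefficients of P (leading first) from row k
-- on has s zero entries, then the coefficients of P from x^0 on.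
module _ (P : Monic) (s k : ℕ) {N} (N≡ : N ≡ s ℕ.+ suc (deg P) ℕ.+ k) where

  sylEntry-reversed-before : ∀ i → i < s → sylEntry P k (N ∸ suc i) ≡ + 0
  sylEntry-reversed-before i i<s = trans (cong (sylEntry P k) (m≡n+1+o⇒m∸[1+n]≡o i _ N≡′))
                                         (sylEntry-beyond P k (o ℕ.+ suc (deg P)) (ℕP.m≤n+m (suc (deg P)) o))
    where
    o = proj₁ (ℕP.m≤n⇒∃[o]m+o≡n i<s)
    layout : ∀ i o d k → suc i ℕ.+ o ℕ.+ suc d ℕ.+ k ≡ i ℕ.+ suc (o ℕ.+ suc d ℕ.+ k)
    layout = ℕSolver.solve-∀
    N≡′ = trans N≡ (trans (cong (λ z → z ℕ.+ suc (deg P) ℕ.+ k) (sym (proj₂ (ℕP.m≤n⇒∃[o]m+o≡n i<s))))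
                          (layout i o (deg P) k))

  sylEntry-reversed-band : ∀ i → i ≤ deg P → sylEntry P k (N ∸ suc (s ℕ.+ i)) ≡ mcoeff P i
  sylEntry-reversed-band i i≤d =
    trans (cong (sylEntry P k) (m≡n+1+o⇒m∸[1+n]≡o (s ℕ.+ i) _ N≡′))
      (trans (sylEntry-band P k o (subst (o ≤_) i+o≡d (ℕP.m≤n+m o i)))
             (cong (mcoeff P) (trans (cong (_∸ o) (sym i+o≡d)) (ℕP.m+n∸n≡m i o))))
    where
    o = proj₁ (ℕP.m≤n⇒∃[o]m+o≡n i≤d)
    i+o≡d = proj₂ (ℕP.m≤n⇒∃[o]m+o≡n i≤d)
    layout : ∀ s i o k → s ℕ.+ suc (i ℕ.+ o) ℕ.+ k ≡ s ℕ.+ i ℕ.+ suc (o ℕ.+ k)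
    layout = ℕSolver.solve-∀
    N≡′ = trans N≡ (trans (cong (λ z → s ℕ.+ suc z ℕ.+ k) (sym i+o≡d)) (layout s i o k))

  sylEntry-reversed-after : ∀ j → j < k → sylEntry P k (N ∸ suc (s ℕ.+ suc (deg P) ℕ.+ j)) ≡ + 0
  sylEntry-reversed-after j j<k = trans (cong (sylEntry P k) (m≡n+1+o⇒m∸[1+n]≡o _ o N≡′))
                                        (sylEntry-before P k o (subst (o <_) 1+j+o≡k (s≤s (ℕP.m≤n+m o j))))
    where
    o = proj₁ (ℕP.m≤n⇒∃[o]m+o≡n j<k)
    1+j+o≡k = proj₂ (ℕP.m≤n⇒∃[o]m+o≡n j<k)
    layout : ∀ s d j o → s ℕ.+ suc d ℕ.+ (suc j ℕ.+ o) ≡ s ℕ.+ suc d ℕ.+ j ℕ.+ suc o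
    layout = ℕSolver.solve-∀
    N≡′ = trans N≡ (trans (cong (s ℕ.+ suc (deg P) ℕ.+_) (sym 1+j+o≡k)) (layout s (deg P) j o))

sumTo-sylEntry : ∀ P s k N x → N ≡ s ℕ.+ suc (deg P) ℕ.+ k →
  sumTo N (λ m → x ^ m * sylEntry P k (N ∸ suc m)) ≡ x ^ s * eval P x
sumTo-sylEntry P s k N x N≡ =
  trans (cong (λ n → sumTo n f) N≡)
    (trans (sumTo-window s (suc (deg P)) k f (λ i → x ^ s * (mcoeff P i * x ^ i)) before inside after)
           (sumTo-*ˡ (suc (deg P)) (x ^ s) _))
  where
  f = λ m → x ^ m * sylEntry P k (N ∸ suc m)
  before : ∀ i → i < s → f i ≡ + 0
  before i i<s = trans (cong (x ^ i *_) (sylEntry-reversed-before P s k N≡ i i<s)) (ℤP.*-zeroʳ (x ^ i))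
  reorder : ∀ a b c → a * b * c ≡ a * (c * b)
  reorder = solve-∀
  inside : ∀ i → i < suc (deg P) → f (s ℕ.+ i) ≡ x ^ s * (mcoeff P i * x ^ i)
  inside i (s≤s i≤d) =
    trans (cong₂ _*_ (ℤP.^-distribˡ-+-* x s i) (sylEntry-reversed-band P s k N≡ i i≤d))
          (reorder (x ^ s) (x ^ i) (mcoeff P i))
  after : ∀ j → j < k → f (s ℕ.+ suc (deg P) ℕ.+ j) ≡ + 0
  after j j<k = trans (cong (x ^ (s ℕ.+ suc (deg P) ℕ.+ j) *_) (sylEntry-reversed-after P s k N≡ j j<k))
                      (ℤP.*-zeroʳ (x ^ (s ℕ.+ suc (deg P) ℕ.+ j)))

sylvesterEntry : Monic → Monic → ℕ → ℕ → ℤ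
sylvesterEntry A B r c with c ℕ.<? deg B
... | yes _ = sylEntry A c r
... | no  _ = sylEntry B (c ∸ deg B) r

sylvester≡sylvesterEntry : ∀ A B r c → sylvester A B r c ≡ sylvesterEntry A B (toℕ r) (toℕ c)
sylvester≡sylvesterEntry A B r c with toℕ c ℕ.<? deg B
... | yes _ = refl
... | no  _ = refl

sylvesterEntry-A : ∀ A B r c → c < deg B → sylvesterEntry A B r c ≡ sylEntry A c r
sylvesterEntry-A A B r c c<e with c ℕ.<? deg B
... | yes _   = refl
... | no  c≮e = ⊥-elim (c≮e c<e)

sylvesterEntry-B : ∀ A B r c → ¬ c < deg B → sylvesterEntry A B r c ≡ sylEntry B (c ∸ deg B) r
sylvesterEntry-B A B r c c≮e with c ℕ.<? deg B
... | yes c<e = ⊥-elim (c≮e c<e)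
... | no  _   = refl

sylvesterRows : (A B : Monic) → ℕ → Row (deg A ℕ.+ deg B)
sylvesterRows A B m c = sylvesterEntry A B (deg A ℕ.+ deg B ∸ suc m) (toℕ c)

resultant≡det-sylvesterRows : ∀ A B → resultant A B ≡ det (deg A ℕ.+ deg B) (bottomUp (sylvesterRows A B))
resultant≡det-sylvesterRows A B = det-cong _ λ r c →
  trans (sylvester≡sylvesterEntry A B r c)
        (cong (λ i → sylvesterEntry A B i (toℕ c))
              (trans (cong toℕ (sym (FinP.opposite-involutive r))) (FinP.opposite-prop (Fin.opposite r))))

sylvesterColumn-A : ∀ A B x c → toℕ c < deg B →
  Σ[ s ∈ ℕ ] horner (deg A ℕ.+ deg B) (sylvesterRows A B) x c ≡ x ^ s * eval A x
sylvesterColumn-A A B x c c<e = o , trans (horner≡sumTo (deg A ℕ.+ deg B) (sylvesterRows A B) x c)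
  (trans (sumTo-cong (deg A ℕ.+ deg B) (λ m _ → cong (x ^ m *_) (sylvesterEntry-A A B _ (toℕ c) c<e)))
         (sumTo-sylEntry A o (toℕ c) (deg A ℕ.+ deg B) x
            (trans (cong (deg A ℕ.+_) (sym (proj₂ (ℕP.m≤n⇒∃[o]m+o≡n c<e)))) (layout (deg A) (toℕ c) o))))
  where
  o = proj₁ (ℕP.m≤n⇒∃[o]m+o≡n c<e)
  layout : ∀ d c o → d ℕ.+ (suc c ℕ.+ o) ≡ o ℕ.+ suc d ℕ.+ c
  layout = ℕSolver.solve-∀

sylvesterColumn-B : ∀ A B x c → ¬ toℕ c < deg B →
  Σ[ s ∈ ℕ ] horner (deg A ℕ.+ deg B) (sylvesterRows A B) x c ≡ x ^ s * eval B x
sylvesterColumn-B A B x c c≮e = o , trans (horner≡sumTo (deg A ℕ.+ deg B) (sylvesterRows A B) x c)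
  (trans (sumTo-cong (deg A ℕ.+ deg B) (λ m _ → cong (x ^ m *_)
            (trans (sylvesterEntry-B A B _ (toℕ c) c≮e) (cong (λ k → sylEntry B k (deg A ℕ.+ deg B ∸ suc m)) c∸e≡c′))))
         (sumTo-sylEntry B o c′ (deg A ℕ.+ deg B) x
            (trans (cong (ℕ._+ deg B) (sym (proj₂ (ℕP.m≤n⇒∃[o]m+o≡n c′<d)))) (layout c′ o (deg B)))))
  where
  e+c′≡c = proj₂ (ℕP.m≤n⇒∃[o]m+o≡n (ℕP.≮⇒≥ c≮e))
  c′ = proj₁ (ℕP.m≤n⇒∃[o]m+o≡n (ℕP.≮⇒≥ c≮e))
  c∸e≡c′ : toℕ c ∸ deg B ≡ c′
  c∸e≡c′ = trans (cong (_∸ deg B) (sym e+c′≡c)) (ℕP.m+n∸m≡n (deg B) c′)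
  c′<d : c′ < deg A
  c′<d = ℕP.+-cancelʳ-< (deg B) c′ (deg A)
           (subst (_< deg A ℕ.+ deg B) (trans (sym e+c′≡c) (ℕP.+-comm (deg B) c′)) (FinP.toℕ<n c))
  o = proj₁ (ℕP.m≤n⇒∃[o]m+o≡n c′<d)
  layout : ∀ c′ o e → suc c′ ℕ.+ o ℕ.+ e ≡ o ℕ.+ suc e ℕ.+ c′
  layout = ℕSolver.solve-∀

G∣horner-sylvesterRows : ∀ A B x c → G A B x ∣′ horner (deg A ℕ.+ deg B) (sylvesterRows A B) x c
G∣horner-sylvesterRows A B x c with toℕ c ℕ.<? deg B
... | yes c<e = let s , column≡ = sylvesterColumn-A A B x c c<e in
  subst (G A B x ∣′_) (sym column≡) (∣′.∣n⇒∣m*n (x ^ s) (∣′.∣ᵤ⇒∣ (gcd[i,j]∣i (eval A x) (eval B x))))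
... | no  c≮e = let s , column≡ = sylvesterColumn-B A B x c c≮e in
  subst (G A B x ∣′_) (sym column≡) (∣′.∣n⇒∣m*n (x ^ s) (∣′.∣ᵤ⇒∣ (gcd[i,j]∣j (eval A x) (eval B x))))

-- Points and divisors indexed by Fin ℓ are extended to ℕ by the junk value 0.
extend : ∀ {ℓ} → (Fin ℓ → ℤ) → ℕ → ℤ
extend {zero}  f m       = + 0
extend {suc ℓ} f zero    = f Fin.zero
extend {suc ℓ} f (suc m) = extend (f ∘ Fin.suc) m

extend-toℕ : ∀ {ℓ} (F : ℕ → ℤ → ℤ) (f : Fin ℓ → ℤ) m → m < ℓ →
  extend (λ i → F (toℕ i) (f i)) m ≡ F m (extend f m)
extend-toℕ {suc ℓ} F f zero    _           = refl
extend-toℕ {suc ℓ} F f (suc m) (s≤s m<ℓ) = extend-toℕ (F ∘ suc) (f ∘ Fin.suc) m m<ℓ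

extend-pointwise : ∀ {ℓ} (R : ℤ → ℤ → Set) (f g : Fin ℓ → ℤ) → (∀ i → R (f i) (g i)) →
  ∀ m → m < ℓ → R (extend f m) (extend g m)
extend-pointwise {suc ℓ} R f g fRg zero    _         = fRg Fin.zero
extend-pointwise {suc ℓ} R f g fRg (suc m) (s≤s m<ℓ) =
  extend-pointwise R (f ∘ Fin.suc) (g ∘ Fin.suc) (fRg ∘ Fin.suc) m m<ℓ

prodFin≡prodTo : ∀ ℓ (f : Fin ℓ → ℤ) → prodFin ℓ f ≡ prodTo ℓ (extend f)
prodFin≡prodTo zero    f = refl
prodFin≡prodTo (suc ℓ) f =
  trans (cong (f Fin.zero *_) (prodFin≡prodTo ℓ (f ∘ Fin.suc))) (sym (prodTo-sucˡ ℓ (extend f)))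

vandermonde≡newtonProduct : ∀ ℓ (n : Fin ℓ → ℤ) → vandermonde ℓ n ≡ newtonProduct (extend n) ℓ
vandermonde≡newtonProduct ℓ n =
  trans (prodFin≡prodTo ℓ (λ j → factor (toℕ j) (n j)))
        (prodTo-cong ℓ (λ m m<ℓ → trans (extend-toℕ factor n m m<ℓ) (factor≡newton m (extend n m) (ℕP.<⇒≤ m<ℓ))))
  where
  factor : ℕ → ℤ → ℤ
  factor k y = prodFin ℓ (λ i → if does (toℕ i ℕ.<? k) then y - n i else + 1)
  factor≡newton : ∀ k y → k ≤ ℓ → factor k y ≡ newton (extend n) k y
  factor≡newton k y k≤ℓ =
    trans (prodFin≡prodTo ℓ _)
      (trans (prodTo-cong ℓ (λ i i<ℓ → extend-toℕ (λ i z → if does (i ℕ.<? k) then y - z else + 1) n i i<ℓ))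
             (prodTo-truncate k ℓ (λ i → y - extend n i) k≤ℓ))

prodFin∣resultant*vandermonde : ∀ A B ℓ → ℓ ≤ deg A ℕ.+ deg B → (n q : Fin ℓ → ℤ) →
  (∀ i → q i ∣ G A B (n i)) → prodFin ℓ q ∣ resultant A B * vandermonde ℓ n
prodFin∣resultant*vandermonde A B ℓ ℓ≤N n q q∣G =
  ∣′.∣⇒∣ᵤ (subst₂ _∣′_ (sym (prodFin≡prodTo ℓ q)) det≡
             (det-divisible-rows N ℓ (evalRows ℓ) (extend q) ℓ≤N q∣row))
  where
  N = deg A ℕ.+ deg B
  open NewtonBasis (sylvesterRows A B) (extend n)
  q∣row : ∀ m → m < ℓ → ∀ c → extend q m ∣′ evalRows ℓ m c
  q∣row m m<ℓ c =
    subst (extend q m ∣′_) (sym (cong-app (prefix-< {G = sylvesterRows A B} m<ℓ) c))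
      (∣′.∣-trans (extend-pointwise (λ a b → a ∣′ G A B b) q n (∣′.∣ᵤ⇒∣ ∘ q∣G) m m<ℓ)
                  (G∣horner-sylvesterRows A B (extend n m) c))
  det≡ : det N (bottomUp (evalRows ℓ)) ≡ resultant A B * vandermonde ℓ n
  det≡ = begin
    det N (bottomUp (evalRows ℓ))                                     ≡⟨ det-evalRows ℓ ℓ≤N ⟩
    newtonProduct (extend n) ℓ * det N (bottomUp (sylvesterRows A B))
      ≡⟨ cong₂ _*_ (vandermonde≡newtonProduct ℓ n) (resultant≡det-sylvesterRows A B) ⟨
    vandermonde ℓ n * resultant A B                                   ≡⟨ ℤP.*-comm (vandermonde ℓ n) (resultant A B) ⟩
    resultant A B * vandermonde ℓ n                                   ∎
    where open ≡-Reasoning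

-- Prime powers and valuations

p^k∣u*x⇒p^k∣x : ∀ {p} → Prime p → ∀ k u x → ¬ p ∣ℕ u → p ℕ.^ k ∣ℕ u ℕ.* x → p ℕ.^ k ∣ℕ x
p^k∣u*x⇒p^k∣x     pp zero    u x _   _ = ℕ∣.1∣ x
p^k∣u*x⇒p^k∣x {p} pp (suc k) u x p∤u p^k+1∣u*x
  with euclidsLemma u x pp (ℕ∣.∣-trans (ℕ∣.m∣m*n (p ℕ.^ k)) p^k+1∣u*x)
... | inj₁ p∣u = ⊥-elim (p∤u p∣u)
... | inj₂ (ℕ∣.divides x′ refl) =
  subst (p ℕ.* p ℕ.^ k ∣ℕ_) (ℕP.*-comm p x′) (ℕ∣.*-monoʳ-∣ p (p^k∣u*x⇒p^k∣x pp k u x′ p∤u p^k∣u*x′))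
  where
  instance _ = prime⇒nonZero pp
  reorder : ∀ p u x′ → u ℕ.* (x′ ℕ.* p) ≡ p ℕ.* (u ℕ.* x′)
  reorder = ℕSolver.solve-∀
  p^k∣u*x′ : p ℕ.^ k ∣ℕ u ℕ.* x′
  p^k∣u*x′ = ℕ∣.*-cancelˡ-∣ p (subst (p ℕ.* p ℕ.^ k ∣ℕ_) (reorder p u x′) p^k+1∣u*x)

valuation-cancel : ∀ {p} → Prime p → ∀ v a D x → p ℕ.^ v ∣ℕ D → ¬ p ℕ.^ suc v ∣ℕ D →
  p ℕ.^ a ∣ℕ D ℕ.* x → p ℕ.^ (a ∸ v) ∣ℕ x
valuation-cancel {p} pp v a D x (ℕ∣.divides u refl) p^v+1∤D p^a∣D*x with a ℕ.≤? v
... | yes a≤v = subst (λ z → p ℕ.^ z ∣ℕ x) (sym (ℕP.m≤n⇒m∸n≡0 a≤v)) (ℕ∣.1∣ x)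
... | no  a≰v = p^k∣u*x⇒p^k∣x pp (a ∸ v) u x p∤u (ℕ∣.*-cancelˡ-∣ (p ℕ.^ v) p^v*p^[a-v]∣p^v*[u*x])
  where
  instance
    _ = prime⇒nonZero pp
    _ = ℕP.m^n≢0 p v
  p^a≡ : p ℕ.^ a ≡ p ℕ.^ v ℕ.* p ℕ.^ (a ∸ v)
  p^a≡ = trans (cong (p ℕ.^_) (sym (ℕP.m+[n∸m]≡n (ℕP.<⇒≤ (ℕP.≰⇒> a≰v))))) (ℕP.^-distribˡ-+-* p v (a ∸ v))
  reorder : ∀ u q x → u ℕ.* q ℕ.* x ≡ q ℕ.* (u ℕ.* x)
  reorder = ℕSolver.solve-∀
  p^v*p^[a-v]∣p^v*[u*x] = subst₂ _∣ℕ_ p^a≡ (reorder u (p ℕ.^ v) x) p^a∣D*x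
  p∤u : ¬ p ∣ℕ u
  p∤u (ℕ∣.divides w refl) = p^v+1∤D (ℕ∣.divides w (reassoc w p (p ℕ.^ v)))
    where
    reassoc : ∀ w p q → w ℕ.* p ℕ.* q ≡ w ℕ.* (p ℕ.* q)
    reassoc = ℕSolver.solve-∀

p^k∣1⇒k≡0 : ∀ {p} → Prime p → ∀ k → p ℕ.^ k ∣ℕ 1 → k ≡ 0
p^k∣1⇒k≡0 pp zero    _      = refl
p^k∣1⇒k≡0 {p} pp (suc k) p^k+1∣1 =
  ⊥-elim (ℕP.<-irrefl (sym (ℕP.m*n≡1⇒m≡1 p (p ℕ.^ k) (ℕ∣.∣1⇒≡1 p^k+1∣1)))
                      (ℕ.nonTrivial⇒n>1 p {{prime⇒nonTrivial pp}}))

∣+p^k∣≡p^k : ∀ p k → ℤ.∣ (+ p) ^ k ∣ ≡ p ℕ.^ k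
∣+p^k∣≡p^k p zero    = refl
∣+p^k∣≡p^k p (suc k) = trans (ℤP.abs-* (+ p) ((+ p) ^ k)) (cong (p ℕ.*_) (∣+p^k∣≡p^k p k))

deg≡0⇒eval≡1 : ∀ A → deg A ≡ 0 → ∀ x → eval A x ≡ + 1
deg≡0⇒eval≡1 (monic zero a) refl x = refl

G≡1-of-constant : ∀ A B → deg A ≡ 0 ⊎ deg B ≡ 0 → ∀ x → G A B x ≡ + 1
G≡1-of-constant A B (inj₁ dA≡0) x =
  trans (cong (λ a → gcd a (eval B x)) (deg≡0⇒eval≡1 A dA≡0 x)) (gcd-zeroˡ (eval B x))
G≡1-of-constant A B (inj₂ dB≡0) x =
  trans (cong (gcd (eval A x)) (deg≡0⇒eval≡1 B dB≡0 x)) (gcd-zeroʳ (eval A x))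

N<2⇒constant : ∀ d e → ¬ 2 ≤ d ℕ.+ e → d ≡ 0 ⊎ e ≡ 0
N<2⇒constant zero    e       _   = inj₁ refl
N<2⇒constant (suc d) zero    _   = inj₂ refl
N<2⇒constant (suc d) (suc e) N≱2 = ⊥-elim (N≱2 (s≤s (subst (1 ≤_) (sym (ℕP.+-suc d e)) (s≤s z≤n))))

p^[ω₁+ω₂]∣resultant*[n₂-n₁] : ∀ A B → 2 ≤ deg A ℕ.+ deg B → ∀ p ω₁ ω₂ n₁ n₂ →
  (+ p) ^ ω₁ ∣ G A B n₁ → (+ p) ^ ω₂ ∣ G A B n₂ → (+ p) ^ (ω₁ ℕ.+ ω₂) ∣ resultant A B * (n₂ - n₁)
p^[ω₁+ω₂]∣resultant*[n₂-n₁] A B 2≤N p ω₁ ω₂ n₁ n₂ p^ω₁∣G p^ω₂∣G =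
  subst₂ _∣_ product≡ (cong (resultant A B *_) vandermonde≡)
    (prodFin∣resultant*vandermonde A B 2 2≤N points divisors divisors∣G)
  where
  points divisors : Fin 2 → ℤ
  points Fin.zero      = n₁
  points (Fin.suc _)   = n₂
  divisors Fin.zero    = (+ p) ^ ω₁
  divisors (Fin.suc _) = (+ p) ^ ω₂
  divisors∣G : ∀ i → divisors i ∣ G A B (points i)
  divisors∣G Fin.zero    = p^ω₁∣G
  divisors∣G (Fin.suc _) = p^ω₂∣G
  product≡ : prodFin 2 divisors ≡ (+ p) ^ (ω₁ ℕ.+ ω₂)
  product≡ = trans (cong ((+ p) ^ ω₁ *_) (ℤP.*-identityʳ _)) (sym (ℤP.^-distribˡ-+-* (+ p) ω₁ ω₂))
  simplify : ∀ x → (+ 1 * (+ 1 * + 1)) * ((x * (+ 1 * + 1)) * + 1) ≡ x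
  simplify = solve-∀
  vandermonde≡ : vandermonde 2 points ≡ n₂ - n₁
  vandermonde≡ = simplify (n₂ - n₁)

valuation-bound : ∀ A B p → Prime p → ∀ ω₁ ω₂ n₁ n₂ →
  (+ p) ^ ω₁ ∣ G A B n₁ → (+ p) ^ ω₂ ∣ G A B n₂ →
  ∀ v → HasValuation p (resultant A B) v → (+ p) ^ ((ω₁ ℕ.+ ω₂) ∸ v) ∣ (n₂ - n₁)
valuation-bound A B p pp ω₁ ω₂ n₁ n₂ p^ω₁∣G p^ω₂∣G v (p^v∣Δ , p^v+1∤Δ) with 2 ℕ.≤? deg A ℕ.+ deg B
... | yes 2≤N =
  subst (_∣ℕ ℤ.∣ n₂ - n₁ ∣) (sym (∣+p^k∣≡p^k p ((ω₁ ℕ.+ ω₂) ∸ v)))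
    (valuation-cancel pp v (ω₁ ℕ.+ ω₂) ℤ.∣ resultant A B ∣ ℤ.∣ n₂ - n₁ ∣
      (subst (_∣ℕ ℤ.∣ resultant A B ∣) (∣+p^k∣≡p^k p v) p^v∣Δ)
      (p^v+1∤Δ ∘ subst (_∣ℕ ℤ.∣ resultant A B ∣) (sym (∣+p^k∣≡p^k p (suc v))))
      (subst₂ _∣ℕ_ (∣+p^k∣≡p^k p (ω₁ ℕ.+ ω₂)) (ℤP.abs-* (resultant A B) (n₂ - n₁))
              (p^[ω₁+ω₂]∣resultant*[n₂-n₁] A B 2≤N p ω₁ ω₂ n₁ n₂ p^ω₁∣G p^ω₂∣G)))
... | no  N≱2 = subst (λ k → (+ p) ^ k ∣ (n₂ - n₁)) (sym exponent≡0) (ℕ∣.1∣ _)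
  where
  ω≡0 : ∀ ω x → (+ p) ^ ω ∣ G A B x → ω ≡ 0
  ω≡0 ω x p^ω∣G = p^k∣1⇒k≡0 pp ω (subst₂ _∣ℕ_ (∣+p^k∣≡p^k p ω)
                                     (cong ℤ.∣_∣ (G≡1-of-constant A B (N<2⇒constant _ _ N≱2) x)) p^ω∣G)
  exponent≡0 : (ω₁ ℕ.+ ω₂) ∸ v ≡ 0
  exponent≡0 = trans (cong₂ (λ a b → (a ℕ.+ b) ∸ v) (ω≡0 ω₁ n₁ p^ω₁∣G) (ω≡0 ω₂ n₂ p^ω₂∣G))
                     (ℕP.0∸n≡0 v)

theorem7 : (A B : Monic) → Coprime (toPoly A) (toPoly B) →
    (∀ (ℓ : ℕ) → ℓ ≤ deg A ℕ.+ deg B → (n q : Fin ℓ → ℤ) →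
    (∀ i → q i ∣ G A B (n i)) →
    prodFin ℓ q ∣ (resultant A B * vandermonde ℓ n))
    ×
    (∀ (p : ℕ) → Prime p → (ω₁ ω₂ : ℕ) → (n₁ n₂ : ℤ) →
    (+ p) ^ ω₁ ∣ G A B n₁ → (+ p) ^ ω₂ ∣ G A B n₂ →
    ∀ (v : ℕ) → HasValuation p (resultant A B) v →
    (+ p) ^ ((ω₁ ℕ.+ ω₂) ℕ.∸ v) ∣ (n₂ - n₁))
theorem7 A B _ = prodFin∣resultant*vandermonde A B , valuation-bound A B
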